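{- If $G$ is the incidence graph of a transversal design $TD(k,n)$ with $k \ge 4$, then $\zeta(G) \le n + k - 4$.
   Context: A transversal design $TD(k,n)$ is a pair $(X,\mathcal{B})$ where $X$ is a set of $kn$ points partitioned into $k$ groups $G_1,\dots,G_k$ each of size $n$, and $\mathcal{B}$ is a collection of blocks of size $k$, each containing exactly one point of each group, such that every two points from different groups lie in exactly one block. Its incidence graph is the bipartite graph on $X \cup \mathcal{B}$ with $x \sim B$ iff $x \in B$. Localization game on a connected graph $G$ with $m$ cops: the robber chooses a starting vertex, invisible to the cops. Each round the cops choose any $m$ vertices (no adjacency restriction) and each learns its distance to the robber; the cops win if after finitely many rounds they determine the robber's vertex uniquely; otherwise the robber moves to a neighbour or stays. The robber knows the cops' strategy. $\zeta(G)$ is the least $m$ for which $m$ cops can guarantee capture. -}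

module Defs where

open import Data.Nat using (ℕ; zero; suc; _≤_; _+_; _∸_)
open import Data.Fin using (Fin)
open import Data.Product using (Σ; _×_; _,_; ∃)
open import Data.Sum using (_⊎_; inj₁; inj₂)
open import Data.List using (List; []; _∷_)
open import Relation.Binary.PropositionalEquality using (_≡_; _≢_)

record Graph : Set₁ where
  field
    V   : Set
    Adj : V → V → Set

module _ (G : Graph) where
  open Graph G

  data Walk : V → V → ℕ → Set where
    here : ∀ {u} → Walk u u zero
    step : ∀ {u w v d} → Adj u w → Walk w v d → Walk u v (suc d)

  IsDist : V → V → ℕ → Set
  IsDist u v d = Walk u v d × (∀ d' → Walk u v d' → d ≤ d')

  Trajectory : (ℕ → V) → Set
  Trajectory r = ∀ t → (r (suc t) ≡ r t) ⊎ Adj (r t) (r (suc t))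

  -- history of responses of rounds 0..t-1 (most recent first)
  hist : {A : Set} → (ℕ → A) → ℕ → List A
  hist ρ zero    = []
  hist ρ (suc t) = ρ t ∷ hist ρ t

  -- a (deterministic, adaptive) strategy for m cops: from the responses
  -- received so far, choose the m probed vertices of the current round
  Strategy : ℕ → Set
  Strategy m = List (Fin m → ℕ) → Fin m → V

  Generates : ∀ {m} → Strategy m → (ℕ → V) → (ℕ → Fin m → ℕ) → Set
  Generates σ r ρ = ∀ t c → IsDist (σ (hist ρ t) c) (r t) (ρ t c)

  Winning : ∀ {m} → Strategy m → Set
  Winning σ =
    ∀ r ρ → Trajectory r → Generates σ r ρ →
      ∃ λ t → ∀ r' ρ' → Trajectory r' → Generates σ r' ρ' →
        (∀ s → s ≤ t → ρ' s ≡ ρ s) → r' t ≡ r t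

  CopsWin : ℕ → Set
  CopsWin m = Σ (Strategy m) Winning

  ζ≤ : ℕ → Set
  ζ≤ m = Σ ℕ λ m' → m' ≤ m × CopsWin m'

-- Transversal designs TD(k,n): points are (group i, index a) ∈ Fin k × Fin n,
-- the groups being G_i = {i} × Fin n; a block meets each group in exactly one
-- point, so a block is a function Fin k → Fin n.

record TD (k n : ℕ) : Set where
  field
    b     : ℕ
    block : Fin b → Fin k → Fin n
    unique-block : ∀ (i j : Fin k) → i ≢ j → ∀ (x y : Fin n) →
      Σ (Fin b) λ B → (block B i ≡ x × block B j ≡ y) ×
        (∀ B' → block B' i ≡ x → block B' j ≡ y → B' ≡ B)

data IncAdj {k n b : ℕ} (block : Fin b → Fin k → Fin n) :
    (Fin k × Fin n) ⊎ Fin b → (Fin k × Fin n) ⊎ Fin b → Set where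
  pt-bl : ∀ {i x B} → block B i ≡ x → IncAdj block (inj₁ (i , x)) (inj₂ B)
  bl-pt : ∀ {i x B} → block B i ≡ x → IncAdj block (inj₂ B) (inj₁ (i , x))

IncidenceGraph : ∀ {k n} → TD k n → Graph
IncidenceGraph {k} {n} D = record
  { V   = (Fin k × Fin n) ⊎ Fin (TD.b D)
  ; Adj = IncAdj (TD.block D)
  }

-- A strategy is presented as a machine whose states carry a set of candidate positions for
-- the robber: every round either pins the robber down or passes to a state of smaller measure
-- whose candidates include every vertex the robber can move to.
-- In the incidence graph the parity of a distance tells points from blocks, two points are at
-- distance 2 exactly when they lie in different groups, and n − 1 cops on all but one of n
-- candidates identify the robber's candidate (the uncovered one if no cop reports the expected
-- distance). With n + k − 4 cops there are three phases.
-- Sweep: cops on group g = 0, 1, … learn whether the robber is on a block (and which point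
-- (g , x) it contains), on a point of group g, or on a point of a later group.
-- Pencil: once the robber is on or next to a block through (j , x), n − 1 cops on the blocks
-- joining (j , x) to a second group recover that block, and k − 3 cops on the remaining
-- groups find the robber's group unless it is one of two groups.
-- Pair: one cop at the point of that block in the first of these two groups decides between
-- the two points and their neighbouring blocks.
-- For n = 1 one sweeping cop suffices, no TD(k , 2) exists for k ≥ 4, and for n = 0 the graph
-- is empty.
module Submission where

open import Defs
open import Data.Nat as ℕ using (ℕ; zero; suc; _+_; _∸_; _≤_; _<_; _≟_; _<?_; z≤n; s≤s; parity)
open import Data.Nat.Properties
  using (≤-refl; ≤-trans; ≤-reflexive; <⇒≤; <⇒≱; ≤-<-trans; n≤0⇒n≡0; n≤1+n; n<1+n; m≤m+n;
         +-comm; +-monoʳ-<; +-∸-assoc; ∸-monoʳ-<)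
open import Data.Parity.Base using (Parity; 0ℙ; 1ℙ; _⁻¹) renaming (_+_ to _⊕_)
open import Data.Parity.Properties using (⁻¹-involutive; ⁻¹-selfInverse; suc-homo-⁻¹; p+p≡0ℙ)
open import Data.Fin as Fin
  using (Fin; zero; suc; toℕ; fromℕ; fromℕ<; inject₁; punchIn; punchOut; _↑ˡ_; _↑ʳ_)
open import Data.Fin.Properties
  using (any?; ≤∧≢⇒<; toℕ<n; toℕ-fromℕ<; punchInᵢ≢i; punchIn-injective; punchIn-punchOut)
open import Data.Fin.Relation.Unary.Top using (view; ‵fromℕ; ‵inject₁)
open import Data.Vec.Functional using (_++_)
open import Data.Vec.Functional.Properties using (lookup-++ˡ; lookup-++ʳ)
open import Data.List using (List; []; _∷_)
open import Data.Product using (∃; _×_; _,_; proj₁; proj₂)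
open import Data.Product.Properties using (,-injectiveʳ)
open import Data.Sum using (_⊎_; inj₁; inj₂; [_,_]′)
open import Data.Sum.Properties using (inj₁-injective; inj₂-injective)
open import Data.Unit using (⊤; tt)
open import Data.Empty using (⊥-elim)
open import Function using (_∘_; _∘′_)
open import Relation.Nullary using (¬_; yes; no; contradiction)
open import Relation.Nullary.Decidable using (_×-dec_; ¬?)
open import Relation.Binary.PropositionalEquality

findOrLast : ∀ {l} → ℕ → (Fin l → ℕ) → Fin (suc l)
findOrLast v f with any? (λ y → f y ≟ v)
... | yes (y , _) = inject₁ y
... | no _        = fromℕ _

findOrLast-unique : ∀ {l} v (f : Fin l → ℕ) z →
  (∀ y → f y ≡ v → inject₁ y ≡ z) → (∀ y → inject₁ y ≡ z → f y ≡ v) → findOrLast v f ≡ z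
findOrLast-unique v f z found⇒z z⇒found with any? (λ y → f y ≟ v)
... | yes (y , fy≡v) = found⇒z y fy≡v
... | no none with view z
...   | ‵fromℕ     = refl
...   | ‵inject₁ y = contradiction (y , z⇒found y refl) none

punchIn-first-two : ∀ {m} {i j : Fin (3 + m)} → i ≢ j →
  (∀ e → punchIn j (suc (suc e)) ≢ i) → i ≡ punchIn j zero ⊎ i ≡ punchIn j (suc zero)
punchIn-first-two i≢j not-later with punchOut (i≢j ∘ sym) | punchIn-punchOut (i≢j ∘ sym)
... | zero        | eq = inj₁ (sym eq)
... | suc zero    | eq = inj₂ (sym eq)
... | suc (suc e) | eq = contradiction eq (not-later e)

other-of-two : {a c e : Fin 2} → a ≢ e → c ≢ e → a ≡ c
other-of-two {zero}     {zero}                _   _   = refl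
other-of-two {suc zero} {suc zero}            _   _   = refl
other-of-two {zero}     {suc zero} {zero}     a≢e _   = contradiction refl a≢e
other-of-two {zero}     {suc zero} {suc zero} _   c≢e = contradiction refl c≢e
other-of-two {suc zero} {zero}     {zero}     _   c≢e = contradiction refl c≢e
other-of-two {suc zero} {zero}     {suc zero} a≢e _   = contradiction refl a≢e

Move : (G : Graph) → Graph.V G → Graph.V G → Set
Move G u v = v ≡ u ⊎ Graph.Adj G u v

module _ {G : Graph} where
  open Graph G

  IsDist-zero⇒≡ : ∀ {u v d} → IsDist G u v d → d ≡ 0 → u ≡ v
  IsDist-zero⇒≡ (here , _) refl = refl

  IsDist-refl⇒zero : ∀ {u d} → IsDist G u u d → d ≡ 0
  IsDist-refl⇒zero (_ , minimal) = n≤0⇒n≡0 (minimal 0 here)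

  IsDist-one⇒Adj : ∀ {u v d} → IsDist G u v d → d ≡ 1 → Adj u v
  IsDist-one⇒Adj (step a here , _) refl = a

  Adj⇒IsDist-one : (∀ {u} → ¬ Adj u u) → ∀ {u v d} → Adj u v → IsDist G u v d → d ≡ 1
  Adj⇒IsDist-one irrefl {d = zero}        a p with refl ← IsDist-zero⇒≡ p refl = ⊥-elim (irrefl a)
  Adj⇒IsDist-one irrefl {d = suc zero}    a p = refl
  Adj⇒IsDist-one irrefl {d = suc (suc d)} a (_ , minimal) with s≤s () ← minimal 1 (step a here)

  module _ (side : V → Parity) (alternates : ∀ {u v} → Adj u v → side v ≡ side u ⁻¹) where

    walk-parity : ∀ {u v d} → Walk G u v d → parity d ≡ side u ⊕ side v
    walk-parity {u} here = sym (p+p≡0ℙ (side u))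
    walk-parity {u} {v} {suc d} (step {w = w} a rest) = begin
      parity (suc d)          ≡⟨ ⁻¹-selfInverse (suc-homo-⁻¹ d) ⟨
      parity d ⁻¹             ≡⟨ cong _⁻¹ (walk-parity rest) ⟩
      (side w ⊕ side v) ⁻¹    ≡⟨ cong (λ p → (p ⊕ side v) ⁻¹) (alternates a) ⟩
      (side u ⁻¹ ⊕ side v) ⁻¹ ≡⟨ ⁻¹-⊕-⁻¹ (side u) ⟩
      side u ⊕ side v         ∎
      where
        open ≡-Reasoning
        ⁻¹-⊕-⁻¹ : ∀ p {q} → (p ⁻¹ ⊕ q) ⁻¹ ≡ p ⊕ q
        ⁻¹-⊕-⁻¹ 0ℙ = ⁻¹-involutive _
        ⁻¹-⊕-⁻¹ 1ℙ = refl

    IsDist-parity : ∀ {u v d} → IsDist G u v d → parity d ≡ side u ⊕ side v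
    IsDist-parity = walk-parity ∘′ proj₁

module _ (G : Graph) where
  open Graph G

  Answers : ∀ {m} → (Fin m → V) → V → (Fin m → ℕ) → Set
  Answers probe v r = ∀ c → IsDist G (probe c) v (r c)

  hist-cong : ∀ {A : Set} {ρ ρ′ : ℕ → A} t → (∀ s → s < t → ρ′ s ≡ ρ s) → hist G ρ′ t ≡ hist G ρ t
  hist-cong zero    agree = refl
  hist-cong (suc t) agree =
    cong₂ _∷_ (agree t ≤-refl) (hist-cong t (λ s s<t → agree s (≤-trans s<t (n≤1+n t))))

  record Machine (m : ℕ) : Set₁ where
    field
      State : Set
      start : State
      probe : State → Fin m → V
      next  : State → (Fin m → ℕ) → State ⊎ V

    run : List (Fin m → ℕ) → State ⊎ V
    run []      = inj₁ start
    run (r ∷ h) = [ (λ S → next S r) , inj₂ ]′ (run h)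

    strategy : Strategy G m
    strategy h = [ probe , (λ v _ → v) ]′ (run h)

  Progress : {State : Set} → (State → V → Set) → (State → ℕ) → State → V → State ⊎ V → Set
  Progress Cand μ S v (inj₁ S′) = μ S′ < μ S × (∀ v′ → Move G v v′ → Cand S′ v′)
  Progress Cand μ S v (inj₂ w)  = v ≡ w

  record Certificate {m} (M : Machine m) : Set₁ where
    open Machine M
    field
      Cand         : State → V → Set
      μ            : State → ℕ
      start-covers : ∀ v → Cand start v
      sound        : ∀ S v r → Cand S v → Answers (probe S) v r → Progress Cand μ S v (next S r)

  module _ {m} {M : Machine m} (C : Certificate M) where
    open Machine M
    open Certificate C

    module _ {r ρ} (moves : Trajectory G r) (responses : Generates G strategy r ρ) where

      running-answers : ∀ t {S} → run (hist G ρ t) ≡ inj₁ S → Answers (probe S) (r t) (ρ t)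
      running-answers t eq = subst (λ s → Answers ([ probe , (λ v _ → v) ]′ s) (r t) (ρ t)) eq (responses t)

      running-invariant : ∀ t S → run (hist G ρ t) ≡ inj₁ S → Cand S (r t) × t + μ S ≤ μ start
      running-invariant zero    S refl = start-covers (r zero) , ≤-refl
      running-invariant (suc t) S eq with run (hist G ρ t) in running
      ... | inj₁ S₀ =
        let cand , bound = running-invariant t S₀ running
            μ< , covers  = subst (Progress Cand μ S₀ (r t)) eq
                             (sound S₀ (r t) (ρ t) cand (running-answers t running))
        in covers (r (suc t)) (moves t) , ≤-trans (+-monoʳ-< t μ<) bound
      running-invariant (suc t) S () | inj₂ _

      announcement-correct : ∀ {t S w} → run (hist G ρ t) ≡ inj₁ S → next S (ρ t) ≡ inj₂ w → r t ≡ w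
      announcement-correct {t} {S} running announces =
        subst (Progress Cand μ S (r t)) announces
          (sound S (r t) (ρ t) (proj₁ (running-invariant t S running)) (running-answers t running))

    Announcement : (ℕ → Fin m → ℕ) → Set
    Announcement ρ = ∃ λ t → ∃ λ S → ∃ λ w → run (hist G ρ t) ≡ inj₁ S × next S (ρ t) ≡ inj₂ w

    announcement-before : ∀ ρ T {w} → run (hist G ρ T) ≡ inj₂ w → Announcement ρ
    announcement-before ρ zero    ()
    announcement-before ρ (suc T) stopped with run (hist G ρ T) in now
    ... | inj₁ S = T , S , _ , now , stopped
    ... | inj₂ _ = announcement-before ρ T now

    announced : ∀ {r ρ} → Trajectory G r → Generates G strategy r ρ → Announcement ρ
    announced {ρ = ρ} moves responses with run (hist G ρ (suc (μ start))) in eq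
    ... | inj₁ S =
      ⊥-elim (<⇒≱ (s≤s (m≤m+n (μ start) (μ S))) (proj₂ (running-invariant moves responses _ S eq)))
    ... | inj₂ _ = announcement-before ρ (suc (μ start)) eq

    certified⇒winning : Winning G strategy
    certified⇒winning r ρ moves responses with announced moves responses
    ... | t , S , w , running , announces = t , λ r′ ρ′ moves′ responses′ agree →
      let running′   = trans (cong run (hist-cong t (λ s s<t → agree s (<⇒≤ s<t)))) running
          announces′ = trans (cong (next S) (agree t ≤-refl)) announces
      in trans (announcement-correct moves′ responses′ running′ announces′)
               (sym (announcement-correct moves responses running announces))

  certified⇒CopsWin : ∀ {m} {M : Machine m} → Certificate M → CopsWin G m
  certified⇒CopsWin {M = M} C = Machine.strategy M , certified⇒winning C

  empty⇒CopsWin : ¬ V → CopsWin G 0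
  empty⇒CopsWin no-vertex = (λ _ ()) , λ r _ _ _ → ⊥-elim (no-vertex (r 0))

pattern pt i x = inj₁ (i , x)
pattern bl B   = inj₂ B

module Incidence {k n} (D : TD k n) where
  open TD D public

  G : Graph
  G = IncidenceGraph D

  V : Set
  V = Graph.V G

  Dist : V → V → ℕ → Set
  Dist = IsDist G

  module _ {i j : Fin k} (i≢j : i ≢ j) (x y : Fin n) where
    blockThrough : Fin b
    blockThrough = proj₁ (unique-block i j i≢j x y)

    blockThrough-∋ˡ : block blockThrough i ≡ x
    blockThrough-∋ˡ = proj₁ (proj₁ (proj₂ (unique-block i j i≢j x y)))

    blockThrough-∋ʳ : block blockThrough j ≡ y
    blockThrough-∋ʳ = proj₂ (proj₁ (proj₂ (unique-block i j i≢j x y)))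

    blockThrough-unique : ∀ B → block B i ≡ x → block B j ≡ y → B ≡ blockThrough
    blockThrough-unique = proj₂ (proj₂ (unique-block i j i≢j x y))

  blocks-agree⇒≡ : ∀ {i j} → i ≢ j → ∀ {B C} → block B i ≡ block C i → block B j ≡ block C j → B ≡ C
  blocks-agree⇒≡ i≢j {B} {C} eqᵢ eqⱼ =
    trans (blockThrough-unique i≢j _ _ B refl refl) (sym (blockThrough-unique i≢j _ _ C (sym eqᵢ) (sym eqⱼ)))

  blocks-meet-once : ∀ {i j B C} → B ≢ C → i ≢ j → block B i ≡ block C i → block B j ≢ block C j
  blocks-meet-once B≢C i≢j meetᵢ meetⱼ = B≢C (blocks-agree⇒≡ i≢j meetᵢ meetⱼ)

  side : V → Parity
  side (pt _ _) = 0ℙ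
  side (bl _)   = 1ℙ

  side-alternates : ∀ {u v} → IncAdj block u v → side v ≡ side u ⁻¹
  side-alternates (pt-bl _) = refl
  side-alternates (bl-pt _) = refl

  Dist-parity : ∀ {u v d} → Dist u v d → parity d ≡ side u ⊕ side v
  Dist-parity = IsDist-parity side side-alternates

  no-loops : ∀ {u} → ¬ IncAdj block u u
  no-loops ()

  Dist-one⇒∈ : ∀ {i x B d} → Dist (pt i x) (bl B) d → d ≡ 1 → block B i ≡ x
  Dist-one⇒∈ p refl with pt-bl e ← IsDist-one⇒Adj p refl = e

  ∈⇒Dist-one : ∀ {i x B d} → Dist (pt i x) (bl B) d → block B i ≡ x → d ≡ 1
  ∈⇒Dist-one p e = Adj⇒IsDist-one no-loops (pt-bl e) p

  Dist-one⇒∋ : ∀ {i x B d} → Dist (bl B) (pt i x) d → d ≡ 1 → block B i ≡ x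
  Dist-one⇒∋ p refl with bl-pt e ← IsDist-one⇒Adj p refl = e

  ∋⇒Dist-one : ∀ {i x B d} → Dist (bl B) (pt i x) d → block B i ≡ x → d ≡ 1
  ∋⇒Dist-one p e = Adj⇒IsDist-one no-loops (bl-pt e) p

  Dist-other-group : ∀ {i j x y d} → i ≢ j → Dist (pt i x) (pt j y) d → d ≡ 2
  Dist-other-group {d = zero} i≢j p with refl ← IsDist-zero⇒≡ p refl = contradiction refl i≢j
  Dist-other-group {d = suc zero} i≢j p with () ← Dist-parity p
  Dist-other-group {d = suc (suc zero)} i≢j p = refl
  Dist-other-group {d = suc (suc (suc d))} i≢j (_ , minimal)
    with s≤s (s≤s ()) ← minimal 2 (step (pt-bl (blockThrough-∋ˡ i≢j _ _))
                                   (step (bl-pt (blockThrough-∋ʳ i≢j _ _)) here))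

  Dist-not-two⇒same-group : ∀ {i j x y d} → Dist (pt i x) (pt j y) d → d ≢ 2 → i ≡ j
  Dist-not-two⇒same-group {i} {j} p d≢2 with i Fin.≟ j
  ... | yes i≡j = i≡j
  ... | no i≢j  = contradiction (Dist-other-group i≢j p) d≢2

  Dist-two⇒other-group : ∀ {i j x y d} → Dist (pt i x) (pt j y) d → d ≡ 2 → i ≢ j
  Dist-two⇒other-group (step (pt-bl refl) (step (bl-pt refl) here) , minimal) refl refl with () ← minimal 0 here

  Unswept : Fin k → V → Set
  Unswept g (pt i _) = g Fin.≤ i
  Unswept g (bl _)   = ⊤

  module _ {g i : Fin k} (g≤i : g Fin.≤ i) (g≢i : g ≢ i) where
    private
      g<i : g Fin.< i
      g<i = ≤∧≢⇒< g≤i g≢i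

    sweep-continues : suc (toℕ g) ℕ.< k
    sweep-continues = ≤-<-trans g<i (toℕ<n i)

    sweep-step : ∀ {x} (g+1<k : suc (toℕ g) ℕ.< k) →
      k ∸ toℕ (fromℕ< g+1<k) ℕ.< k ∸ toℕ g × (∀ v → Move G (pt i x) v → Unswept (fromℕ< g+1<k) v)
    sweep-step {x} g+1<k rewrite toℕ-fromℕ< g+1<k = ∸-monoʳ-< (n<1+n (toℕ g)) (<⇒≤ g+1<k) , moves
      where
        moves : ∀ v → Move G (pt i x) v → Unswept (fromℕ< g+1<k) v
        moves v (inj₁ refl)      = subst (ℕ._≤ toℕ i) (sym (toℕ-fromℕ< g+1<k)) g<i
        moves v (inj₂ (pt-bl _)) = tt

module Probing {k l} (D : TD k (suc l)) where
  open Incidence D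

  locate-point : ∀ {g x} {d : Fin l → ℕ} →
    (∀ y → Dist (pt g (inject₁ y)) (pt g x) (d y)) → findOrLast 0 d ≡ x
  locate-point {d = d} answers = findOrLast-unique 0 d _
    (λ y d≡0 → ,-injectiveʳ (inj₁-injective (IsDist-zero⇒≡ (answers y) d≡0)))
    (λ { y refl → IsDist-refl⇒zero (answers y) })

  locate-block : ∀ {g B} {d : Fin l → ℕ} →
    (∀ y → Dist (pt g (inject₁ y)) (bl B) (d y)) → findOrLast 1 d ≡ block B g
  locate-block {d = d} answers = findOrLast-unique 1 d _
    (λ y d≡1 → sym (Dist-one⇒∈ (answers y) d≡1))
    (λ y eq → ∈⇒Dist-one (answers y) (sym eq))

  locate-block-through : ∀ {g j w C} (g≢j : g ≢ j) {d : Fin l → ℕ} → block C g ≡ w →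
    (∀ y → Dist (pt j (inject₁ y)) (bl C) (d y)) → C ≡ blockThrough g≢j w (findOrLast 1 d)
  locate-block-through g≢j C∋w answers = blockThrough-unique g≢j _ _ _ C∋w (sym (locate-block answers))

  module Pencil {j h : Fin k} (j≢h : j ≢ h) (x : Fin (suc l)) where
    line : Fin (suc l) → Fin b
    line = blockThrough j≢h x

    line-through : ∀ {B z} → block B j ≡ x → block B h ≡ z → line z ≡ B
    line-through B∋x B∋z = sym (blockThrough-unique j≢h x _ _ B∋x B∋z)

    line-meeting : ∀ {B i z} → i ≢ j → block B j ≡ x → block (line z) i ≡ block B i → line z ≡ B
    line-meeting i≢j B∋x meet = blocks-agree⇒≡ i≢j meet (trans (blockThrough-∋ˡ j≢h x _) (sym B∋x))

    lines-meet-only-at-centre : ∀ {i z z′} → i ≢ j → block (line z) i ≡ block (line z′) i → z ≡ z′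
    lines-meet-only-at-centre {z = z} {z′} i≢j meet = begin
      z                 ≡⟨ blockThrough-∋ʳ j≢h x z ⟨
      block (line z) h  ≡⟨ cong (λ C → block C h) (line-meeting i≢j (blockThrough-∋ˡ j≢h x z′) meet) ⟩
      block (line z′) h ≡⟨ blockThrough-∋ʳ j≢h x z′ ⟩
      z′                ∎
      where open ≡-Reasoning

    locate-line : ∀ {B} {d : Fin l → ℕ} → block B j ≡ x →
      (∀ y → Dist (bl (line (inject₁ y))) (bl B) (d y)) → findOrLast 0 d ≡ block B h
    locate-line {B} {d} B∋x answers = findOrLast-unique 0 d _
      (λ y d≡0 → trans (sym (blockThrough-∋ʳ j≢h x _))
                       (cong (λ C → block C h) (inj₂-injective (IsDist-zero⇒≡ (answers y) d≡0))))
      (λ y z≡y → IsDist-refl⇒zero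
                   (subst (λ C → Dist (bl C) (bl B) (d y)) (line-through B∋x (sym z≡y)) (answers y)))

    locate-line-point : ∀ {B i} {d : Fin l → ℕ} → i ≢ j → block B j ≡ x →
      (∀ y → Dist (bl (line (inject₁ y))) (pt i (block B i)) (d y)) → findOrLast 1 d ≡ block B h
    locate-line-point {B} {i} {d} i≢j B∋x answers = findOrLast-unique 1 d _
      (λ y d≡1 → trans (sym (blockThrough-∋ʳ j≢h x _))
                       (cong (λ C → block C h) (line-meeting i≢j B∋x (Dist-one⇒∋ (answers y) d≡1))))
      (λ y z≡y → ∋⇒Dist-one (answers y) (cong (λ C → block C i) (line-through B∋x (sym z≡y))))

no-vertices : ∀ {k′} (D : TD (suc k′) 0) → ¬ Graph.V (IncidenceGraph D)
no-vertices D (pt _ ())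
no-vertices D (bl B) with () ← TD.block D B zero

-- B₀₁ and B₁₀ each meet B₀₀ once, so outside the groups g₀ , g₁ both avoid the point of B₀₀
-- and, as n = 2, agree; agreeing in g₂ and g₃ they coincide.
¬TD-order-two : ∀ {k′} → ¬ TD (4 + k′) 2
¬TD-order-two {k′} D =
  B₀₁≢B₁₀ (blocks-agree⇒≡ {g₂} {g₃} (λ ()) (agree-beyond (λ ()) (λ ())) (agree-beyond (λ ()) (λ ())))
  where
    open Incidence D
    g₀ g₁ g₂ g₃ : Fin (4 + k′)
    g₀ = zero
    g₁ = suc zero
    g₂ = suc (suc zero)
    g₃ = suc (suc (suc zero))
    0≢1 : g₀ ≢ g₁
    0≢1 ()
    B₀₀ B₀₁ B₁₀ : Fin b
    B₀₀ = blockThrough 0≢1 zero zero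
    B₀₁ = blockThrough 0≢1 zero (suc zero)
    B₁₀ = blockThrough 0≢1 (suc zero) zero
    ∋₀ : ∀ x y → block (blockThrough 0≢1 x y) g₀ ≡ x
    ∋₀ = blockThrough-∋ˡ 0≢1
    ∋₁ : ∀ x y → block (blockThrough 0≢1 x y) g₁ ≡ y
    ∋₁ = blockThrough-∋ʳ 0≢1
    differ : ∀ {B C g x y} → block B g ≡ x → block C g ≡ y → x ≢ y → B ≢ C
    differ B∋x C∋y x≢y refl = x≢y (trans (sym B∋x) C∋y)
    B₀₁≢B₀₀ : B₀₁ ≢ B₀₀
    B₀₁≢B₀₀ = differ (∋₁ _ _) (∋₁ _ _) λ ()
    B₁₀≢B₀₀ : B₁₀ ≢ B₀₀
    B₁₀≢B₀₀ = differ (∋₀ _ _) (∋₀ _ _) λ ()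
    B₀₁≢B₁₀ : B₀₁ ≢ B₁₀
    B₀₁≢B₁₀ = differ (∋₀ _ _) (∋₀ _ _) λ ()
    agree-beyond : ∀ {g} → g₀ ≢ g → g₁ ≢ g → block B₀₁ g ≡ block B₁₀ g
    agree-beyond 0≢g 1≢g = other-of-two
      (blocks-meet-once B₀₁≢B₀₀ 0≢g (trans (∋₀ _ _) (sym (∋₀ _ _))))
      (blocks-meet-once B₁₀≢B₀₀ 1≢g (trans (∋₁ _ _) (sym (∋₁ _ _))))

module SinglePoint {k′} (D : TD (2 + k′) 1) where
  open Incidence D

  theBlock : Fin b
  theBlock = blockThrough {zero} {suc zero} (λ ()) zero zero

  ≡theBlock : ∀ B → B ≡ theBlock
  ≡theBlock B = blockThrough-unique (λ ()) zero zero B (only _) (only _)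
    where
      only : (x : Fin 1) → x ≡ zero
      only zero = refl

  next : Fin (2 + k′) → (Fin 1 → ℕ) → Fin (2 + k′) ⊎ V
  next g r with parity (r zero)
  ... | 1ℙ = inj₂ (bl theBlock)
  ... | 0ℙ with r zero ≟ 2
  ...   | no _  = inj₂ (pt g zero)
  ...   | yes _ with suc (toℕ g) <? 2 + k′
  ...     | yes g+1<k = inj₁ (fromℕ< g+1<k)
  ...     | no _      = inj₂ (pt g zero) -- never taken, by sweep-continues

  machine : Machine G 1
  machine = record { State = Fin (2 + k′) ; start = zero ; probe = λ g _ → pt g zero ; next = next }

  μ : Fin (2 + k′) → ℕ
  μ g = 2 + k′ ∸ toℕ g

  sound : ∀ g v r → Unswept g v → Answers G (λ _ → pt g zero) v r → Progress G Unswept μ g v (next g r)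
  sound g (bl B) r _ answers rewrite Dist-parity (answers zero) = cong bl (≡theBlock B)
  sound g (pt i zero) r unswept answers rewrite Dist-parity (answers zero) with r zero ≟ 2
  ... | no d≢2 with refl ← Dist-not-two⇒same-group (answers zero) d≢2 = refl
  ... | yes d≡2 with suc (toℕ g) <? 2 + k′ | Dist-two⇒other-group (answers zero) d≡2
  ...   | yes g+1<k | g≢i = sweep-step unswept g≢i g+1<k
  ...   | no g+1≮k  | g≢i = contradiction (sweep-continues unswept g≢i) g+1≮k

  certificate : Certificate G machine
  certificate = record
    { Cand         = Unswept
    ; μ            = μ
    ; start-covers = λ { (pt _ _) → z≤n ; (bl _) → tt }
    ; sound        = sound
    }

  copsWin : CopsWin G 1
  copsWin = certified⇒CopsWin G certificate

module ManyPoints {k′ n′} (D : TD (4 + k′) (3 + n′)) where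
  open Incidence D
  open Probing D

  Cops : ℕ
  Cops = (1 + k′) + (2 + n′)

  fixed : (Fin Cops → ℕ) → Fin (1 + k′) → ℕ
  fixed r e = r (e ↑ˡ (2 + n′))

  scan : (Fin Cops → ℕ) → Fin (2 + n′) → ℕ
  scan r y = r ((1 + k′) ↑ʳ y)

  first second : Fin (4 + k′) → Fin (4 + k′)
  first  j = punchIn j zero
  second j = punchIn j (suc zero)

  other : Fin (4 + k′) → Fin (1 + k′) → Fin (4 + k′)
  other j e = punchIn j (suc (suc e))

  first≢ : ∀ j → first j ≢ j
  first≢ j = punchInᵢ≢i j zero

  second≢ : ∀ j → second j ≢ j
  second≢ j = punchInᵢ≢i j (suc zero)

  module _ (j : Fin (4 + k′)) (x : Fin (3 + n′)) where
    open Pencil (first≢ j ∘ sym) x public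

  data State : Set where
    sweep  : Fin (4 + k′) → State
    pencil : Fin (4 + k′) → Fin (3 + n′) → State
    pair   : Fin (4 + k′) → Fin b → State

  fixedProbe : State → Fin (1 + k′) → V
  fixedProbe (sweep g)    _ = pt g zero
  fixedProbe (pencil j x) e = pt (other j e) zero
  fixedProbe (pair j B)   _ = pt (first j) (block B (first j))

  scanProbe : State → Fin (2 + n′) → V
  scanProbe (sweep g)    y = pt g (inject₁ y)
  scanProbe (pencil j x) y = bl (line j x (inject₁ y))
  scanProbe (pair j B)   y = pt j (inject₁ y)

  probe : State → Fin Cops → V
  probe S = fixedProbe S ++ scanProbe S

  next : State → (Fin Cops → ℕ) → State ⊎ V
  next (sweep g) r with parity (fixed r zero)
  ... | 1ℙ = inj₁ (pencil g (findOrLast 1 (scan r)))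
  ... | 0ℙ with fixed r zero ≟ 2
  ...   | no _ = inj₂ (pt g (findOrLast 0 (scan r)))
  ...   | yes _ with suc (toℕ g) <? 4 + k′
  ...     | yes g+1<k = inj₁ (sweep (fromℕ< g+1<k))
  ...     | no _      = inj₂ (pt g zero) -- never taken, by sweep-continues
  next (pencil j x) r with parity (fixed r zero)
  ... | 1ℙ = inj₂ (bl (line j x (findOrLast 0 (scan r))))
  ... | 0ℙ with (scan r zero ≟ 1) ×-dec (scan r (suc zero) ≟ 1)
  ...   | yes _ = inj₂ (pt j x)
  ...   | no _ with any? (λ e → ¬? (fixed r e ≟ 2))
  ...     | yes (e , _) = inj₂ (pt (other j e) (block (line j x (findOrLast 1 (scan r))) (other j e)))
  ...     | no _        = inj₁ (pair j (line j x (findOrLast 1 (scan r))))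
  next (pair j B) r with fixed r zero
  ... | 0 = inj₂ (pt (first j) (block B (first j)))
  ... | 1 = inj₂ (bl (blockThrough (first≢ j) (block B (first j)) (findOrLast 1 (scan r))))
  ... | 2 = inj₂ (pt (second j) (block B (second j)))
  ... | _ = inj₂ (bl (blockThrough (second≢ j) (block B (second j)) (findOrLast 1 (scan r))))

  Cand : State → V → Set
  Cand (sweep g)    v = Unswept g v
  Cand (pencil j x) v = ∃ λ B → block B j ≡ x × Move G (bl B) v
  Cand (pair j B)   v =
    Move G (pt (first j) (block B (first j))) v ⊎ Move G (pt (second j) (block B (second j))) v

  μ : State → ℕ
  μ (sweep g)    = 2 + (4 + k′ ∸ toℕ g)
  μ (pencil _ _) = 1
  μ (pair _ _)   = 0

  module _ (S : State) {v r} (answers : Answers G (probe S) v r) where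
    fixed-answers : ∀ e → Dist (fixedProbe S e) v (fixed r e)
    fixed-answers e =
      subst (λ u → Dist u v (fixed r e)) (lookup-++ˡ (fixedProbe S) (scanProbe S) e) (answers (e ↑ˡ _))

    scan-answers : ∀ y → Dist (scanProbe S y) v (scan r y)
    scan-answers y =
      subst (λ u → Dist u v (scan r y)) (lookup-++ʳ (fixedProbe S) (scanProbe S) y) (answers ((1 + k′) ↑ʳ y))

  Sound : State → Set
  Sound S = ∀ v r → Cand S v →
    (∀ e → Dist (fixedProbe S e) v (fixed r e)) → (∀ y → Dist (scanProbe S y) v (scan r y)) →
    Progress G Cand μ S v (next S r)

  sweep-sound : ∀ g → Sound (sweep g)
  sweep-sound g (bl B) r _ fixed-dist scan-dist rewrite Dist-parity (fixed-dist zero) =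
    s≤s (s≤s z≤n) , λ v′ move → B , sym (locate-block scan-dist) , move
  sweep-sound g (pt i x) r unswept fixed-dist scan-dist
    rewrite Dist-parity (fixed-dist zero) with fixed r zero ≟ 2
  ... | no d≢2 with refl ← Dist-not-two⇒same-group (fixed-dist zero) d≢2 =
    cong (pt g) (sym (locate-point scan-dist))
  ... | yes d≡2 with suc (toℕ g) <? 4 + k′ | Dist-two⇒other-group (fixed-dist zero) d≡2
  ...   | yes g+1<k | g≢i = let μ< , moves = sweep-step unswept g≢i g+1<k in s≤s (s≤s μ<) , moves
  ...   | no g+1≮k  | g≢i = contradiction (sweep-continues unswept g≢i) g+1≮k

  module _ {j x B i} {d : Fin (2 + n′) → ℕ} (B∋x : block B j ≡ x)
           (scan-dist : ∀ y → Dist (scanProbe (pencil j x) y) (pt i (block B i)) (d y)) where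
    off-centre : ¬ (d zero ≡ 1 × d (suc zero) ≡ 1) → i ≢ j
    off-centre not-both refl = not-both (on-line zero , on-line (suc zero))
      where
        on-line : ∀ y → d y ≡ 1
        on-line y = ∋⇒Dist-one (scan-dist y) (trans (blockThrough-∋ˡ _ x _) (sym B∋x))

    line-found : i ≢ j → line j x (findOrLast 1 d) ≡ B
    line-found i≢j = line-through j x B∋x (sym (locate-line-point j x i≢j B∋x scan-dist))

  pencil-sound : ∀ j x → Sound (pencil j x)
  pencil-sound j x (bl B) r (B , B∋x , inj₁ refl) fixed-dist scan-dist
    rewrite Dist-parity (fixed-dist zero) =
    cong bl (sym (line-through j x B∋x (sym (locate-line j x B∋x scan-dist))))
  pencil-sound j x (pt i _) r (B , B∋x , inj₂ (bl-pt refl)) fixed-dist scan-dist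
    rewrite Dist-parity (fixed-dist zero) with (scan r zero ≟ 1) ×-dec (scan r (suc zero) ≟ 1)
  ... | yes (d₀≡1 , d₁≡1) with i Fin.≟ j
  ...   | yes refl = cong (pt j) B∋x
  ...   | no i≢j   = contradiction (lines-meet-only-at-centre j x i≢j
                       (trans (Dist-one⇒∋ (scan-dist zero) d₀≡1) (sym (Dist-one⇒∋ (scan-dist (suc zero)) d₁≡1))))
                       λ ()
  pencil-sound j x (pt i _) r (B , B∋x , inj₂ (bl-pt refl)) fixed-dist scan-dist | no not-both
    with off-centre B∋x scan-dist not-both | any? (λ e → ¬? (fixed r e ≟ 2))
  ... | i≢j | yes (e , dₑ≢2) with refl ← Dist-not-two⇒same-group (fixed-dist e) dₑ≢2 =
    cong (λ C → pt i (block C i)) (sym (line-found B∋x scan-dist i≢j))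
  ... | i≢j | no none =
    s≤s z≤n , λ v′ move → subst (λ C → Cand (pair j C) v′) (sym (line-found B∋x scan-dist i≢j)) (at-pair move)
    where
      not-other : ∀ e → other j e ≢ i
      not-other e other≡i = none (e , λ dₑ≡2 → Dist-two⇒other-group (fixed-dist e) dₑ≡2 other≡i)

      at-pair : ∀ {v′} → Move G (pt i (block B i)) v′ → Cand (pair j B) v′
      at-pair with punchIn-first-two i≢j not-other
      ... | inj₁ refl = inj₁
      ... | inj₂ refl = inj₂

  first≢second : ∀ j → first j ≢ second j
  first≢second j eq with () ← punchIn-injective j zero (suc zero) eq

  pair-sound : ∀ j B → Sound (pair j B)
  pair-sound j B _ r (inj₁ (inj₁ refl)) fixed-dist _
    rewrite IsDist-refl⇒zero (fixed-dist zero) = refl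
  pair-sound j B _ r (inj₂ (inj₁ refl)) fixed-dist _
    rewrite Dist-other-group (first≢second j) (fixed-dist zero) = refl
  pair-sound j B _ r (inj₁ (inj₂ (pt-bl C∋a))) fixed-dist scan-dist
    rewrite ∈⇒Dist-one (fixed-dist zero) C∋a = cong bl (locate-block-through (first≢ j) C∋a scan-dist)
  pair-sound j B _ r (inj₂ (inj₂ (pt-bl C∋b))) fixed-dist scan-dist with fixed r zero | fixed-dist zero
  ... | 0 | d = contradiction (IsDist-zero⇒≡ d refl) λ ()
  ... | 1 | d = cong bl (locate-block-through (first≢ j) (Dist-one⇒∈ d refl) scan-dist)
  ... | 2 | d with () ← Dist-parity d
  ... | suc (suc (suc _)) | _ = cong bl (locate-block-through (second≢ j) C∋b scan-dist)

  machine : Machine G Cops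
  machine = record { State = State ; start = sweep zero ; probe = probe ; next = next }

  certificate : Certificate G machine
  certificate = record
    { Cand         = Cand
    ; μ            = μ
    ; start-covers = λ { (pt _ _) → z≤n ; (bl _) → tt }
    ; sound        = λ S v r cand answers →
                       sound S v r cand (fixed-answers S answers) (scan-answers S answers)
    }
    where
      sound : ∀ S → Sound S
      sound (sweep g)    = sweep-sound g
      sound (pencil j x) = pencil-sound j x
      sound (pair j B)   = pair-sound j B

  copsWin : CopsWin G Cops
  copsWin = certified⇒CopsWin G certificate

cops-bound : ∀ k′ n′ → (1 + k′) + (2 + n′) ≤ ((3 + n′) + (4 + k′)) ∸ 4
cops-bound k′ n′ = ≤-reflexive (begin
  (1 + k′) + (2 + n′)           ≡⟨ cong suc (+-comm k′ (2 + n′)) ⟩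
  (3 + n′) + k′                 ≡⟨ +-∸-assoc (3 + n′) (m≤m+n 4 k′) ⟨
  ((3 + n′) + (4 + k′)) ∸ 4     ∎)
  where open ≡-Reasoning

theorem5p1 : ∀ (k n : ℕ) → 4 ≤ k → (D : TD k n) →
    ζ≤ (IncidenceGraph D) ((n + k) ∸ 4)
theorem5p1 _ 0 (s≤s (s≤s (s≤s (s≤s _)))) D = 0 , z≤n , empty⇒CopsWin _ (no-vertices D)
theorem5p1 _ 1 (s≤s (s≤s (s≤s (s≤s _)))) D = 1 , s≤s z≤n , SinglePoint.copsWin D
theorem5p1 _ 2 (s≤s (s≤s (s≤s (s≤s _)))) D = ⊥-elim (¬TD-order-two D)
theorem5p1 (suc (suc (suc (suc k′)))) (suc (suc (suc n′))) (s≤s (s≤s (s≤s (s≤s _)))) D =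
  _ , cops-bound k′ n′ , ManyPoints.copsWin D
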